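{- Fix $k\ge2$ and let $\pi$ be a permutation containing a decreasing subsequence of length $k$, with A-sequence $a_k\cdots a_1$ and B-sequence $b_k\cdots b_1$. If $b_e$ belongs to the A-sequence and $b_{e-1}$ does not, then $b_m$ does not belong to the A-sequence for any $m<e$. Consequently, the set of letters common to the A-sequence and the B-sequence forms a contiguous segment of each of the two sequences.
   Context: Letters of $\pi$ are identified with their values; "$x$ precedes $y$" means $x$ is at a smaller position. The A-sequence $a_k\cdots a_1$ is the lexicographically smallest (as a sequence of values read left to right) decreasing subsequence of $\pi$ of length $k$. The B-sequence $b_k\cdots b_1$ is defined recursively: $b_1$ is the leftmost letter that is the last letter of a decreasing subsequence of length $k$, and for $j\ge2$, $b_j$ is the leftmost letter such that $b_j\cdots b_1$ is a suffix of a decreasing subsequence of length $k$. -}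

module Defs where

open import Data.Nat using (ℕ; _≤_)
open import Data.Fin using (Fin) renaming (_<_ to _<ᶠ_)
open import Data.Fin.Permutation using (Permutation′; _⟨$⟩ʳ_)
open import Data.Product using (Σ; ∃; _×_)
open import Data.Sum using (_⊎_)
open import Relation.Binary.PropositionalEquality using (_≡_)
open import Relation.Nullary using (¬_)

-- A permutation π of [n] maps positions (Fin n) to values (Fin n).
-- A sequence of letters of length k is given by a function  s : ℕ → Fin n  recording
-- the POSITION of each letter; only subscripts 1..k are meaningful.  Following the
-- paper, the sequence is written s_k ⋯ s_1, so s_k is leftmost and s_1 rightmost.
-- Since π is a bijection, a letter (= value) is identified with its position.

val : ∀ {n} → Permutation′ n → Fin n → Fin n
val π p = π ⟨$⟩ʳ p

IsDecSub : ∀ {n} → Permutation′ n → ℕ → (ℕ → Fin n) → Set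
IsDecSub π k s = ∀ i j → 1 ≤ i → i Data.Nat.< j → j ≤ k →
  (s j <ᶠ s i) × (val π (s i) <ᶠ val π (s j))

HasDecSub : ∀ {n} → Permutation′ n → ℕ → Set
HasDecSub π k = ∃ λ s → IsDecSub π k s

LexLeq : ∀ {n} → Permutation′ n → ℕ → (ℕ → Fin n) → (ℕ → Fin n) → Set
LexLeq π k s t =
  (∀ j → 1 ≤ j → j ≤ k → val π (s j) ≡ val π (t j))
  ⊎ (∃ λ j → 1 ≤ j × j ≤ k
       × (∀ i → j Data.Nat.< i → i ≤ k → val π (s i) ≡ val π (t i))
       × (val π (s j) <ᶠ val π (t j)))

IsASeq : ∀ {n} → Permutation′ n → ℕ → (ℕ → Fin n) → Set
IsASeq π k a = IsDecSub π k a × (∀ t → IsDecSub π k t → LexLeq π k a t)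

SuffixExt : ∀ {n} → Permutation′ n → ℕ → ℕ → Fin n → (ℕ → Fin n) → Set
SuffixExt π k j q b = ∃ λ s → IsDecSub π k s × (s j ≡ q)
  × (∀ i → 1 ≤ i → i Data.Nat.< j → s i ≡ b i)

IsBSeq : ∀ {n} → Permutation′ n → ℕ → (ℕ → Fin n) → Set
IsBSeq π k b = ∀ j → 1 ≤ j → j ≤ k →
  SuffixExt π k j (b j) b × (∀ q → q <ᶠ b j → ¬ SuffixExt π k j q b)

InSeq : ∀ {n} → ℕ → Fin n → (ℕ → Fin n) → Set
InSeq k x s = ∃ λ j → 1 ≤ j × j ≤ k × (s j ≡ x)

Contiguous : ∀ {n} → ℕ → (ℕ → Fin n) → (ℕ → Fin n) → Set
Contiguous k s t = ∀ i j l → 1 ≤ i → i ≤ j → j ≤ l → l ≤ k →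
  InSeq k (s i) t → InSeq k (s l) t → InSeq k (s j) t

-- Both sequences are extremal: no decreasing subsequence of length k + 1 starts at a_k (it would
-- give a lexicographically smaller one of length k), and none ends at b_1 (its second letter would
-- be a further-left candidate for b_1).  Splicing segments of A and B into one another therefore
-- forces every common letter a_i = b_e to satisfy e ≤ i, with one offset d = i − e shared by all
-- common letters.  Now let b_m = a_{m+d} and b_e = a_{e+d} be common with nothing common strictly
-- between them and m + 1 < e.  Going down from s = e − 1, each a_{s+d} lies strictly left of and
-- below b_s, since otherwise a splice would beat A lexicographically or extend it past a_k.  At
-- s = m + 1 the subsequence b_k ⋯ b_e a_{e−1+d} ⋯ a_{m+1+d} b_m ⋯ b_1 then beats the choice of
-- b_{m+1}.  So the common letters of B have no gaps, and through the common offset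
-- neither have those of A.
module Submission where

open import Defs
open import Data.Nat using (ℕ; zero; suc; pred; _+_; _∸_; _≤_; _<_; z≤n; s≤s; _≤?_)
open import Data.Nat.Properties
open import Data.Fin using (Fin; toℕ) renaming (_<_ to _<ᶠ_; _≤_ to _≤ᶠ_)
open import Data.Fin.Properties using (toℕ-injective) renaming (_≟_ to _≟ᶠ_)
open import Data.Fin.Permutation using (Permutation′; _⟨$⟩ˡ_; inverseˡ)
open import Data.Product using (_×_; _,_; proj₁; proj₂; ∃; map₁; map₂)
open import Data.Sum using (_⊎_; inj₁; inj₂; [_,_]′)
open import Data.Empty using (⊥; ⊥-elim)
open import Relation.Nullary using (¬_; Dec; yes; no)
open import Relation.Nullary.Decidable using (map′; _×-dec_)
import Relation.Unary as U
open import Relation.Binary.PropositionalEquality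
open import Function using (_∘_)
open import Relation.Binary.Definitions using (tri<; tri≈; tri>)

m≤n⇒∃[o]o+m≡n : ∀ {m n} → m ≤ n → ∃ λ o → o + m ≡ n
m≤n⇒∃[o]o+m≡n m≤n = _ , m∸n+n≡m m≤n

module Chains {n : ℕ} (π : Permutation′ n) where

  infix 4 _↘_ _↗_

  -- In the diagram of π (positions rightwards, values upwards), y lies south-east resp.
  -- north-east of x.

  _↘_ _↗_ : Fin n → Fin n → Set
  x ↘ y = (x <ᶠ y) × (val π y <ᶠ val π x)
  x ↗ y = (x <ᶠ y) × (val π x <ᶠ val π y)

  ↘-trans : ∀ {x y z} → x ↘ y → y ↘ z → x ↘ z
  ↘-trans (x<y , y>x) (y<z , z>y) = <-trans x<y y<z , <-trans z>y y>x

  val-injective : ∀ {x y} → val π x ≡ val π y → x ≡ y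
  val-injective {x} {y} eq = begin
    x                       ≡⟨ inverseˡ π ⟨
    π ⟨$⟩ˡ (val π x)        ≡⟨ cong (π ⟨$⟩ˡ_) eq ⟩
    π ⟨$⟩ˡ (val π y)        ≡⟨ inverseˡ π ⟩
    y                       ∎
    where open ≡-Reasoning

  -- IsDecSub π k s unfolds to Decreasing s 1 k.
  Decreasing : (ℕ → Fin n) → ℕ → ℕ → Set
  Decreasing f lo hi = ∀ i j → lo ≤ i → i < j → j ≤ hi → f j ↘ f i

  module _ {f : ℕ → Fin n} {lo hi : ℕ} (f↓ : Decreasing f lo hi) where

    Decreasing-restrict : ∀ {lo′ hi′} → lo ≤ lo′ → hi′ ≤ hi → Decreasing f lo′ hi′
    Decreasing-restrict lo≤lo′ hi′≤hi i j lo′≤i i<j j≤hi′ =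
      f↓ i j (≤-trans lo≤lo′ lo′≤i) i<j (≤-trans j≤hi′ hi′≤hi)

    Decreasing-cong : ∀ {g} → (∀ j → lo ≤ j → j ≤ hi → f j ≡ g j) → Decreasing g lo hi
    Decreasing-cong f≗g i j lo≤i i<j j≤hi =
      subst₂ _↘_ (f≗g j (≤-trans lo≤i (<⇒≤ i<j)) j≤hi) (f≗g i lo≤i (≤-trans (<⇒≤ i<j) j≤hi))
        (f↓ i j lo≤i i<j j≤hi)

    Decreasing-↘ˡ : ∀ {i j y} → lo ≤ i → i ≤ j → j ≤ hi → f i ↘ y → f j ↘ y
    Decreasing-↘ˡ {i} {j} lo≤i i≤j j≤hi fi↘y with m≤n⇒m<n∨m≡n i≤j
    ... | inj₁ i<j  = ↘-trans (f↓ i j lo≤i i<j j≤hi) fi↘y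
    ... | inj₂ refl = fi↘y

    Decreasing-↘ʳ : ∀ {i j x} → lo ≤ i → i ≤ j → j ≤ hi → x ↘ f j → x ↘ f i
    Decreasing-↘ʳ {i} {j} lo≤i i≤j j≤hi x↘fj with m≤n⇒m<n∨m≡n i≤j
    ... | inj₁ i<j  = ↘-trans x↘fj (f↓ i j lo≤i i<j j≤hi)
    ... | inj₂ refl = x↘fj

    Decreasing-reflects-< : ∀ {i j} → lo ≤ j → i ≤ hi → f j <ᶠ f i → i < j
    Decreasing-reflects-< {i} {j} lo≤j i≤hi fj<fi with <-cmp i j
    ... | tri< i<j _ _  = i<j
    ... | tri≈ _ refl _ = ⊥-elim (<-irrefl refl fj<fi)
    ... | tri> _ _ j<i  = ⊥-elim (<-asym fj<fi (proj₁ (f↓ j i lo≤j j<i i≤hi)))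

    Decreasing-injective : ∀ {i j} → lo ≤ i → i ≤ hi → lo ≤ j → j ≤ hi → f i ≡ f j → i ≡ j
    Decreasing-injective {i} {j} lo≤i i≤hi lo≤j j≤hi fi≡fj with <-cmp i j
    ... | tri< i<j _ _ = ⊥-elim (<-irrefl (cong toℕ (sym fi≡fj)) (proj₁ (f↓ i j lo≤i i<j j≤hi)))
    ... | tri≈ _ i≡j _ = i≡j
    ... | tri> _ _ j<i = ⊥-elim (<-irrefl (cong toℕ fi≡fj) (proj₁ (f↓ j i lo≤j j<i i≤hi)))

  Decreasing-shift : ∀ {f lo hi} d → Decreasing f (lo + d) (hi + d) → Decreasing (λ j → f (j + d)) lo hi
  Decreasing-shift d f↓ i j lo≤i i<j j≤hi =
    f↓ (i + d) (j + d) (+-monoˡ-≤ d lo≤i) (+-monoˡ-< d i<j) (+-monoˡ-≤ d j≤hi)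

  Decreasing-unshift : ∀ {f lo hi} d → Decreasing f lo hi → Decreasing (λ j → f (j ∸ d)) (lo + d) (hi + d)
  Decreasing-unshift {f} {lo} {hi} d f↓ i j lo+d≤i i<j j≤hi+d =
    f↓ (i ∸ d) (j ∸ d) lo≤i∸d (∸-monoˡ-< i<j (≤-trans (m≤n+m d lo) lo+d≤i)) j∸d≤hi
    where
    lo≤i∸d : lo ≤ i ∸ d
    lo≤i∸d = subst (_≤ i ∸ d) (m+n∸n≡m lo d) (∸-monoˡ-≤ d lo+d≤i)
    j∸d≤hi : j ∸ d ≤ hi
    j∸d≤hi = subst (j ∸ d ≤_) (m+n∸n≡m hi d) (∸-monoˡ-≤ d j≤hi+d)

  Decreasing-pred : ∀ {f lo hi} → Decreasing f lo hi → Decreasing (λ j → f (pred j)) (suc lo) (suc hi)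
  Decreasing-pred f↓ (suc i) (suc j) (s≤s lo≤i) (s≤s i<j) (s≤s j≤hi) = f↓ i j lo≤i i<j j≤hi

  splice : ℕ → (ℕ → Fin n) → (ℕ → Fin n) → ℕ → Fin n
  splice c f g j with j ≤? c
  ... | yes _ = f j
  ... | no  _ = g j

  splice-≤ : ∀ {c f g j} → j ≤ c → splice c f g j ≡ f j
  splice-≤ {c} {j = j} j≤c with j ≤? c
  ... | yes _   = refl
  ... | no  j≰c = ⊥-elim (j≰c j≤c)

  splice-> : ∀ {c f g j} → c < j → splice c f g j ≡ g j
  splice-> {c} {j = j} c<j with j ≤? c
  ... | yes j≤c = ⊥-elim (<⇒≱ c<j j≤c)
  ... | no  _   = refl

  Decreasing-splice : ∀ {f g lo c hi} → Decreasing f lo c → Decreasing g (suc c) hi →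
    g (suc c) ↘ f c → Decreasing (splice c f g) lo hi
  Decreasing-splice {f} {g} {lo} {c} {hi} f↓ g↓ seam i j lo≤i i<j j≤hi
    with ≤-<-connex j c | ≤-<-connex i c
  ... | inj₁ j≤c | _ = subst₂ _↘_ (sym (splice-≤ j≤c)) (sym (splice-≤ (≤-trans (<⇒≤ i<j) j≤c)))
                         (f↓ i j lo≤i i<j j≤c)
  ... | inj₂ c<j | inj₁ i≤c = subst₂ _↘_ (sym (splice-> c<j)) (sym (splice-≤ i≤c))
                         (Decreasing-↘ˡ g↓ ≤-refl c<j j≤hi (Decreasing-↘ʳ f↓ lo≤i i≤c ≤-refl seam))
  ... | inj₂ c<j | inj₂ c<i = subst₂ _↘_ (sym (splice-> c<j)) (sym (splice-> c<i))
                         (g↓ i j c<i i<j j≤hi)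

  Decreasing-splice₃ : ∀ {f g h lo c₁ c₂ hi} → Decreasing f lo c₁ → Decreasing g (suc c₁) c₂ →
    Decreasing h (suc c₂) hi → c₁ < c₂ → g (suc c₁) ↘ f c₁ → h (suc c₂) ↘ g c₂ →
    Decreasing (splice c₁ f (splice c₂ g h)) lo hi
  Decreasing-splice₃ f↓ g↓ h↓ c₁<c₂ seam₁ seam₂ =
    Decreasing-splice f↓ (Decreasing-splice g↓ h↓ seam₂) (subst (_↘ _) (sym (splice-≤ c₁<c₂)) seam₁)

InSeq? : ∀ {n} k (x : Fin n) s → Dec (InSeq k x s)
InSeq? k x s = map′ fromBounded toBounded (anyUpTo? (λ j → (1 ≤? j) ×-dec (s j ≟ᶠ x)) (suc k))
  where
  fromBounded : (∃ λ j → j < suc k × (1 ≤ j × s j ≡ x)) → InSeq k x s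
  fromBounded (j , j<1+k , 1≤j , sⱼ≡x) = j , 1≤j , ≤-pred j<1+k , sⱼ≡x
  toBounded : InSeq k x s → ∃ λ j → j < suc k × (1 ≤ j × s j ≡ x)
  toBounded (j , 1≤j , j≤k , sⱼ≡x) = j , s≤s j≤k , 1≤j , sⱼ≡x

step-up : ∀ {p} {P : ℕ → Set p} → U.Decidable P → ∀ {j l} → j ≤ l → ¬ P j → P l →
  ∃ λ x → j ≤ x × x < l × ¬ P x × P (suc x)
step-up P? {l = zero} z≤n ¬Pj Pl = ⊥-elim (¬Pj Pl)
step-up P? {l = suc l} j≤1+l ¬Pj P1+l with m≤n⇒m<n∨m≡n j≤1+l
... | inj₂ refl      = ⊥-elim (¬Pj P1+l)
... | inj₁ (s≤s j≤l) with P? l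
...   | no ¬Pl = l , j≤l , ≤-refl , ¬Pl , P1+l
...   | yes Pl = map₂ (map₂ (map₁ m<n⇒m<1+n)) (step-up P? j≤l ¬Pj Pl)

module ABSequences {n} (π : Permutation′ n) (k : ℕ) (1≤k : 1 ≤ k) (a b : ℕ → Fin n)
  (A : IsASeq π k a) (B : IsBSeq π k b) where

  open Chains π

  InA : ℕ → Set
  InA x = InSeq k (b x) a

  a↓ : Decreasing a 1 k
  a↓ = proj₁ A

  b↓ : Decreasing b 1 k
  b↓ with B k 1≤k ≤-refl
  ... | (s , s↓ , sₖ≡bₖ , s≗b) , _ = Decreasing-cong s↓ s≗b′
    where
    s≗b′ : ∀ j → 1 ≤ j → j ≤ k → s j ≡ b j
    s≗b′ j 1≤j j≤k with m≤n⇒m<n∨m≡n j≤k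
    ... | inj₁ j<k  = s≗b j 1≤j j<k
    ... | inj₂ refl = sₖ≡bₖ

  a-lexMin : ∀ t c → Decreasing t 1 k → 1 ≤ c → c ≤ k → (∀ j → c < j → j ≤ k → t j ≡ a j) →
    val π (a c) ≤ᶠ val π (t c)
  a-lexMin t c t↓ 1≤c c≤k t≗a with proj₂ A t t↓
  ... | inj₁ a≗t = ≤-reflexive (cong toℕ (a≗t c 1≤c c≤k))
  ... | inj₂ (j , _ , j≤k , a≗t-above , aⱼ<tⱼ) with <-cmp j c
  ...   | tri< j<c _ _  = ≤-reflexive (cong toℕ (a≗t-above c j<c c≤k))
  ...   | tri≈ _ refl _ = <⇒≤ aⱼ<tⱼ
  ...   | tri> _ _ c<j  = ⊥-elim (<-irrefl (cong (toℕ ∘ val π) (sym (t≗a j c<j j≤k))) aⱼ<tⱼ)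

  b-leftmost : ∀ s j → Decreasing s 1 k → 1 ≤ j → j ≤ k → (∀ x → 1 ≤ x → x < j → s x ≡ b x) →
    ¬ s j <ᶠ b j
  b-leftmost s j s↓ 1≤j j≤k s≗b sⱼ<bⱼ = proj₂ (B j 1≤j j≤k) (s j) sⱼ<bⱼ (s , s↓ , refl , s≗b)

  no-longer-from-aₖ : ∀ s → Decreasing s 1 (suc k) → s (suc k) ≢ a k
  no-longer-from-aₖ s s↓ s₁₊ₖ≡aₖ =
    <⇒≱ sₖ<aₖ (a-lexMin s k (Decreasing-restrict s↓ ≤-refl (n≤1+n k)) 1≤k ≤-refl nothing-above)
    where
    sₖ<aₖ : val π (s k) <ᶠ val π (a k)
    sₖ<aₖ = subst (λ z → val π (s k) <ᶠ val π z) s₁₊ₖ≡aₖ (proj₂ (s↓ k (suc k) 1≤k ≤-refl ≤-refl))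
    nothing-above : ∀ j → k < j → j ≤ k → s j ≡ a j
    nothing-above j k<j j≤k = ⊥-elim (<⇒≱ k<j j≤k)

  no-longer-to-b₁ : ∀ s → Decreasing s 1 (suc k) → s 1 ≢ b 1
  no-longer-to-b₁ s s↓ s₁≡b₁ =
    b-leftmost (λ j → s (j + 1)) 1 s₁₊↓ ≤-refl 1≤k nothing-below s₂<b₁
    where
    s₁₊↓ : Decreasing (λ j → s (j + 1)) 1 k
    s₁₊↓ = Decreasing-shift 1 (Decreasing-restrict s↓ (s≤s z≤n) (≤-reflexive (+-comm k 1)))
    s₂<b₁ : s 2 <ᶠ b 1
    s₂<b₁ = subst (s 2 <ᶠ_) s₁≡b₁ (proj₁ (s↓ 1 2 ≤-refl ≤-refl (s≤s 1≤k)))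
    nothing-below : ∀ x → 1 ≤ x → x < 1 → s (x + 1) ≡ b x
    nothing-below x 1≤x x<1 = ⊥-elim (<⇒≱ x<1 1≤x)

  a-above-common : ∀ {d m} → 1 ≤ m → suc m + d ≤ k → a (m + d) ≡ b m → a (suc m + d) ↘ b m
  a-above-common {d} {m} 1≤m 1+m+d≤k aₘ≡bₘ =
    subst (a (suc m + d) ↘_) aₘ≡bₘ
      (a↓ (m + d) (suc m + d) (≤-trans 1≤m (m≤m+n m d)) ≤-refl 1+m+d≤k)

  ¬b↘a-above : ∀ {d m e} → 1 ≤ m → m < e → e + d ≤ k → a (m + d) ≡ b m → ¬ b e ↘ a (e + d)
  ¬b↘a-above {d} {m} {e} 1≤m m<e e+d≤k aₘ≡bₘ bₑ↘aₑ =
    no-longer-to-b₁ u u↓ (splice-≤ 1≤m)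
    where
    -- b_k ⋯ b_e a_{e+d} ⋯ a_{m+1+d} b_m ⋯ b_1
    u : ℕ → Fin n
    u = splice m b (splice e (λ j → a (j + d)) (λ j → b (pred j)))
    e≤k : e ≤ k
    e≤k = ≤-trans (m≤m+n e d) e+d≤k
    u↓ : Decreasing u 1 (suc k)
    u↓ = Decreasing-splice₃
      (Decreasing-restrict b↓ ≤-refl (≤-trans (<⇒≤ m<e) e≤k))
      (Decreasing-shift d (Decreasing-restrict a↓ (s≤s z≤n) e+d≤k))
      (Decreasing-pred (Decreasing-restrict b↓ (≤-trans 1≤m (<⇒≤ m<e)) ≤-refl))
      m<e (a-above-common 1≤m (≤-trans (+-monoˡ-≤ d m<e) e+d≤k) aₘ≡bₘ) bₑ↘aₑ

  ¬b↘a-below : ∀ {d q e} → 1 ≤ q → q < e → e + d ≤ k → a (e + d) ≡ b e → ¬ b q ↘ a (q + d)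
  ¬b↘a-below {d} {q} {suc e} 1≤q (s≤s q≤e) 1+e+d≤k a₁₊ₑ≡b₁₊ₑ b_q↘a_q =
    no-longer-from-aₖ u u↓ (trans (splice-> (s≤s q+d≤k)) (splice-> (s≤s 1+e+d≤k)))
    where
    -- a_k ⋯ a_{1+e+d} b_e ⋯ b_q a_{q+d} ⋯ a_1
    u : ℕ → Fin n
    u = splice (q + d) a (splice (suc e + d) (λ j → b (pred (j ∸ d))) (λ j → a (pred j)))
    q+d≤k : q + d ≤ k
    q+d≤k = ≤-trans (+-monoˡ-≤ d (m≤n⇒m≤1+n q≤e)) 1+e+d≤k
    1+e≤k : suc e ≤ k
    1+e≤k = ≤-trans (m≤m+n (suc e) d) 1+e+d≤k
    unshift : ∀ x → b (pred (x + d ∸ d)) ≡ b (pred x)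
    unshift x = cong (b ∘ pred) (m+n∸n≡m x d)
    a₁₊ₑ↘bₑ : a (suc e + d) ↘ b (pred (suc e + d ∸ d))
    a₁₊ₑ↘bₑ = subst₂ _↘_ (sym a₁₊ₑ≡b₁₊ₑ) (sym (unshift (suc e)))
      (b↓ e (suc e) (≤-trans 1≤q q≤e) ≤-refl 1+e≤k)
    u↓ : Decreasing u 1 (suc k)
    u↓ = Decreasing-splice₃
      (Decreasing-restrict a↓ ≤-refl q+d≤k)
      (Decreasing-unshift d (Decreasing-pred (Decreasing-restrict b↓ 1≤q (≤-trans (n≤1+n e) 1+e≤k))))
      (Decreasing-pred (Decreasing-restrict a↓ (s≤s z≤n) ≤-refl))
      (s≤s (+-monoˡ-≤ d q≤e)) (subst (_↘ a (q + d)) (sym (unshift (suc q))) b_q↘a_q) a₁₊ₑ↘bₑ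

  a≢b-ahead : ∀ {i x} → 1 ≤ i → i + suc x ≤ k → a i ≢ b (i + suc x)
  a≢b-ahead {i} {x} 1≤i i+1+x≤k aᵢ≡bₑ =
    no-longer-to-b₁ u (Decreasing-restrict u↓ ≤-refl k<k+1+x) (splice-≤ 1≤e)
    where
    -- a_k ⋯ a_{i+1} b_{i+1+x} ⋯ b_1
    u : ℕ → Fin n
    u = splice (i + suc x) b (λ j → a (j ∸ suc x))
    1≤e : 1 ≤ i + suc x
    1≤e = ≤-trans 1≤i (m≤m+n i (suc x))
    k<k+1+x : suc k ≤ k + suc x
    k<k+1+x = ≤-trans (s≤s (m≤m+n k x)) (≤-reflexive (sym (+-suc k x)))
    seam : a (suc i + suc x ∸ suc x) ↘ b (i + suc x)
    seam = subst₂ _↘_ (cong a (sym (m+n∸n≡m (suc i) (suc x)))) aᵢ≡bₑ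
      (a↓ i (suc i) 1≤i ≤-refl (≤-trans (s≤s (m≤m+n i x)) (subst (_≤ k) (+-suc i x) i+1+x≤k)))
    u↓ : Decreasing u 1 (k + suc x)
    u↓ = Decreasing-splice (Decreasing-restrict b↓ ≤-refl i+1+x≤k)
      (Decreasing-unshift (suc x) (Decreasing-restrict a↓ (s≤s z≤n) ≤-refl)) seam

  common-index-≤ : ∀ {i e} → 1 ≤ i → e ≤ k → a i ≡ b e → e ≤ i
  common-index-≤ {i} {e} 1≤i e≤k aᵢ≡bₑ with ≤-<-connex e i
  ... | inj₁ e≤i = e≤i
  ... | inj₂ i<e with m≤n⇒∃[o]m+o≡n i<e
  ...   | x , refl =
    ⊥-elim (a≢b-ahead 1≤i (subst (_≤ k) i+1+x≡e e≤k) (subst (λ j → a i ≡ b j) i+1+x≡e aᵢ≡bₑ))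
    where
    i+1+x≡e : suc i + x ≡ i + suc x
    i+1+x≡e = sym (+-suc i x)

  common-offset : ∀ {d e m l} → 1 ≤ m → m < e → e + d ≤ k → 1 ≤ l → l ≤ k →
    a (e + d) ≡ b e → a l ≡ b m → l ≡ m + d
  common-offset {d} {e} {m} {l} 1≤m m<e e+d≤k 1≤l l≤k aₑ≡bₑ aₗ≡bₘ with <-cmp l (m + d)
  ... | tri≈ _ l≡m+d _ = l≡m+d
  ... | tri< l<m+d _ _
    with m≤n⇒∃[o]m+o≡n (common-index-≤ 1≤l (≤-trans (<⇒≤ m<e) (≤-trans (m≤m+n e d) e+d≤k)) aₗ≡bₘ)
  ...   | x , refl =
    ⊥-elim (¬b↘a-above 1≤m m<e (≤-trans (+-monoʳ-≤ e (<⇒≤ x<d)) e+d≤k) aₗ≡bₘ bₑ↘aₑ₊ₓ)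
    where
    x<d : x < d
    x<d = +-cancelˡ-< m x d l<m+d
    bₑ↘aₑ₊ₓ : b e ↘ a (e + x)
    bₑ↘aₑ₊ₓ = subst (_↘ a (e + x)) aₑ≡bₑ
      (a↓ (e + x) (e + d) (≤-trans (≤-trans 1≤m (<⇒≤ m<e)) (m≤m+n e x)) (+-monoʳ-< e x<d) e+d≤k)
  common-offset {d} {e} {m} {l} 1≤m m<e e+d≤k 1≤l l≤k aₑ≡bₑ aₗ≡bₘ
    | tri> _ _ m+d<l with m≤n⇒∃[o]o+m≡n (≤-trans (m≤n+m d m) (<⇒≤ m+d<l))
  ...   | q , refl = ⊥-elim (¬b↘a-below 1≤q q<e e+d≤k aₑ≡bₑ b_q↘a_q)
    where
    m<q : m < q
    m<q = +-cancelʳ-< d m q m+d<l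
    1≤q : 1 ≤ q
    1≤q = ≤-trans 1≤m (<⇒≤ m<q)
    q<e : q < e
    q<e = +-cancelʳ-< d q e (Decreasing-reflects-< a↓ (≤-trans (≤-trans 1≤m (<⇒≤ m<e)) (m≤m+n e d)) l≤k
      (subst₂ _<ᶠ_ (sym aₑ≡bₑ) (sym aₗ≡bₘ)
        (proj₁ (b↓ m e 1≤m m<e (≤-trans (m≤m+n e d) e+d≤k)))))
    b_q↘a_q : b q ↘ a (q + d)
    b_q↘a_q = subst (b q ↘_) (sym aₗ≡bₘ) (b↓ m q 1≤m m<q (≤-trans (m≤m+n q d) l≤k))

  common-shift-below : ∀ {i e l m} → 1 ≤ i → i ≤ k → e ≤ k → 1 ≤ l → l ≤ k → 1 ≤ m → m < e →
    a i ≡ b e → a l ≡ b m → i + m ≡ l + e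
  common-shift-below {i} {e} {l} {m} 1≤i i≤k e≤k 1≤l l≤k 1≤m m<e aᵢ≡bₑ aₗ≡bₘ
    with m≤n⇒∃[o]m+o≡n (common-index-≤ 1≤i e≤k aᵢ≡bₑ)
  ... | d , refl with common-offset 1≤m m<e i≤k 1≤l l≤k aᵢ≡bₑ aₗ≡bₘ
  ...   | refl = trans (+-comm (e + d) m) (trans (cong (m +_) (+-comm e d)) (sym (+-assoc m d e)))

  common-shift : ∀ {i e l m} → 1 ≤ i → i ≤ k → e ≤ k → 1 ≤ l → l ≤ k → m ≤ k → 1 ≤ m → 1 ≤ e →
    a i ≡ b e → a l ≡ b m → i + m ≡ l + e
  common-shift {i} {e} {l} {m} 1≤i i≤k e≤k 1≤l l≤k m≤k 1≤m 1≤e aᵢ≡bₑ aₗ≡bₘ with <-cmp m e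
  ... | tri< m<e _ _  = common-shift-below 1≤i i≤k e≤k 1≤l l≤k 1≤m m<e aᵢ≡bₑ aₗ≡bₘ
  ... | tri≈ _ refl _ = cong (_+ m) (Decreasing-injective a↓ 1≤i i≤k 1≤l l≤k (trans aᵢ≡bₑ (sym aₗ≡bₘ)))
  ... | tri> _ _ e<m  = sym (common-shift-below 1≤l l≤k m≤k 1≤i i≤k 1≤e e<m aₗ≡bₘ aᵢ≡bₑ)

  a-val-≤-b-val : ∀ {d m s} → 1 ≤ m → m < s → s + d < k → a (m + d) ≡ b m →
    a (suc s + d) ↘ b s → val π (a (s + d)) ≤ᶠ val π (b s)
  a-val-≤-b-val {d} {m} {s} 1≤m m<s s+d<k aₘ≡bₘ a₁₊ₛ↘bₛ =
    subst (λ x → val π (a (s + d)) ≤ᶠ val π x) tₛ≡bₛ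
      (a-lexMin t (s + d) t↓ (≤-trans 1≤m (≤-trans (<⇒≤ m<s) (m≤m+n s d))) (<⇒≤ s+d<k) t≗a)
    where
    -- a_k ⋯ a_{1+s+d} b_s ⋯ b_{m+1} a_{m+d} ⋯ a_1
    t : ℕ → Fin n
    t = splice (m + d) a (splice (s + d) (λ j → b (j ∸ d)) a)
    s≤k : s ≤ k
    s≤k = ≤-trans (m≤m+n s d) (<⇒≤ s+d<k)
    m+d<s+d : m + d < s + d
    m+d<s+d = +-monoˡ-< d m<s
    unshift : ∀ x → b (x + d ∸ d) ≡ b x
    unshift x = cong b (m+n∸n≡m x d)
    t↓ : Decreasing t 1 k
    t↓ = Decreasing-splice₃
      (Decreasing-restrict a↓ ≤-refl (<⇒≤ (<-trans m+d<s+d s+d<k)))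
      (Decreasing-unshift d (Decreasing-restrict b↓ (s≤s z≤n) s≤k))
      (Decreasing-restrict a↓ (s≤s z≤n) ≤-refl)
      m+d<s+d
      (subst₂ _↘_ (sym (unshift (suc m))) (sym aₘ≡bₘ) (b↓ m (suc m) 1≤m ≤-refl (≤-trans m<s s≤k)))
      (subst (a (suc s + d) ↘_) (sym (unshift s)) a₁₊ₛ↘bₛ)
    t≗a : ∀ j → s + d < j → j ≤ k → t j ≡ a j
    t≗a j s+d<j _ = trans (splice-> (<-trans m+d<s+d s+d<j)) (splice-> s+d<j)
    tₛ≡bₛ : t (s + d) ≡ b s
    tₛ≡bₛ = trans (splice-> m+d<s+d)
      (trans (splice-≤ {s + d} {λ j → b (j ∸ d)} {a} ≤-refl) (unshift s))

  b-leftmost-above-common : ∀ {d m e} → 1 ≤ m → suc m < e → e + d ≤ k →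
    a (m + d) ≡ b m → a (e + d) ≡ b e → ¬ a (suc m + d) <ᶠ b (suc m)
  b-leftmost-above-common {d} {m} {suc e} 1≤m (s≤s m<e) e+d<k aₘ≡bₘ a₁₊ₑ≡b₁₊ₑ =
    b-leftmost u (suc m) u↓ (s≤s z≤n) (≤-trans (≤-trans m<e (m≤m+n e d)) (<⇒≤ e+d<k)) u≗b
      ∘ subst (_<ᶠ b (suc m)) (sym u₁₊ₘ≡a₁₊ₘ)
    where
    -- b_k ⋯ b_{1+e} a_{e+d} ⋯ a_{1+m+d} b_m ⋯ b_1
    u : ℕ → Fin n
    u = splice m b (splice e (λ j → a (j + d)) b)
    u↓ : Decreasing u 1 k
    u↓ = Decreasing-splice₃
      (Decreasing-restrict b↓ ≤-refl (≤-trans (≤-trans (<⇒≤ m<e) (m≤m+n e d)) (<⇒≤ e+d<k)))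
      (Decreasing-shift d (Decreasing-restrict a↓ (s≤s z≤n) (<⇒≤ e+d<k)))
      (Decreasing-restrict b↓ (s≤s z≤n) ≤-refl)
      m<e
      (a-above-common 1≤m (≤-trans (+-monoˡ-≤ d m<e) (<⇒≤ e+d<k)) aₘ≡bₘ)
      (subst (_↘ a (e + d)) a₁₊ₑ≡b₁₊ₑ
        (a↓ (e + d) (suc e + d) (≤-trans 1≤m (≤-trans (<⇒≤ m<e) (m≤m+n e d))) ≤-refl e+d<k))
    u≗b : ∀ x → 1 ≤ x → x < suc m → u x ≡ b x
    u≗b x _ x<1+m = splice-≤ (≤-pred x<1+m)
    u₁₊ₘ≡a₁₊ₘ : u (suc m) ≡ a (suc m + d)
    u₁₊ₘ≡a₁₊ₘ = trans (splice-> {m} {b} ≤-refl) (splice-≤ {e} {λ j → a (j + d)} {b} m<e)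

  module _ {d m e : ℕ} (1≤m : 1 ≤ m) (1+m<e : suc m < e) (e+d≤k : e + d ≤ k)
           (aₘ≡bₘ : a (m + d) ≡ b m) (aₑ≡bₑ : a (e + d) ≡ b e)
           (gap : ∀ x → m < x → x < e → ¬ InA x) where

    a↗b-step : ∀ s → m < s → s < e → a (suc s + d) ≡ b (suc s) ⊎ a (suc s + d) ↗ b (suc s) →
      a (s + d) ↗ b s
    a↗b-step s m<s s<e a₁₊ₛ≡⊎↗b₁₊ₛ = aₛ<bₛ , val-aₛ<val-bₛ
      where
      1+s+d≤k : suc s + d ≤ k
      1+s+d≤k = ≤-trans (+-monoˡ-≤ d s<e) e+d≤k
      1≤s : 1 ≤ s
      1≤s = ≤-trans 1≤m (<⇒≤ m<s)
      1≤s+d : 1 ≤ s + d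
      1≤s+d = ≤-trans 1≤s (m≤m+n s d)
      bₛ∉a : ∀ {j} → 1 ≤ j → j ≤ k → a j ≢ b s
      bₛ∉a {j} 1≤j j≤k aⱼ≡bₛ = gap s m<s s<e (j , 1≤j , j≤k , aⱼ≡bₛ)
      a₁₊ₛ↘aₛ : a (suc s + d) ↘ a (s + d)
      a₁₊ₛ↘aₛ = a↓ (s + d) (suc s + d) 1≤s+d ≤-refl 1+s+d≤k
      b₁₊ₛ<bₛ : b (suc s) <ᶠ b s
      b₁₊ₛ<bₛ = proj₁ (b↓ s (suc s) 1≤s ≤-refl (≤-trans (m≤m+n (suc s) d) 1+s+d≤k))
      a₁₊ₛ<bₛ : a (suc s + d) <ᶠ b s
      a₁₊ₛ<bₛ = [ (λ a₁₊ₛ≡b₁₊ₛ → subst (_<ᶠ b s) (sym a₁₊ₛ≡b₁₊ₛ) b₁₊ₛ<bₛ)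
                , (λ a₁₊ₛ↗b₁₊ₛ → <-trans (proj₁ a₁₊ₛ↗b₁₊ₛ) b₁₊ₛ<bₛ) ]′ a₁₊ₛ≡⊎↗b₁₊ₛ
      val-aₛ<val-bₛ : val π (a (s + d)) <ᶠ val π (b s)
      val-aₛ<val-bₛ with <-cmp (toℕ (val π (b s))) (toℕ (val π (a (suc s + d))))
      ... | tri< below _ _ = ≤∧≢⇒<
              (a-val-≤-b-val 1≤m m<s 1+s+d≤k aₘ≡bₘ (a₁₊ₛ<bₛ , below))
              (bₛ∉a 1≤s+d (<⇒≤ 1+s+d≤k) ∘ val-injective ∘ toℕ-injective)
      ... | tri≈ _ level _ = ⊥-elim (bₛ∉a (s≤s z≤n) 1+s+d≤k (sym (val-injective (toℕ-injective level))))
      ... | tri> _ _ above = <-trans (proj₂ a₁₊ₛ↘aₛ) above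
      aₛ<bₛ : a (s + d) <ᶠ b s
      aₛ<bₛ with <-cmp (toℕ (a (s + d))) (toℕ (b s))
      ... | tri< left _ _  = left
      ... | tri≈ _ same _  = ⊥-elim (bₛ∉a 1≤s+d (<⇒≤ 1+s+d≤k) (toℕ-injective same))
      ... | tri> _ _ right = ⊥-elim (¬b↘a-below 1≤s s<e e+d≤k aₑ≡bₑ (right , val-aₛ<val-bₛ))

    a≡b⊎a↗b : ∀ r s → r + s ≡ e → m < s → a (s + d) ≡ b s ⊎ a (s + d) ↗ b s
    a≡b⊎a↗b zero    s refl  _   = inj₁ aₑ≡bₑ
    a≡b⊎a↗b (suc r) s 1+r+s≡e m<s =
      inj₂ (a↗b-step s m<s s<e (a≡b⊎a↗b r (suc s) (trans (+-suc r s) 1+r+s≡e) (m<n⇒m<1+n m<s)))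
      where
      s<e : s < e
      s<e = subst (s <_) 1+r+s≡e (s≤s (m≤n+m s r))

    gap-impossible : ⊥
    gap-impossible with a≡b⊎a↗b (e ∸ suc m) (suc m) (m∸n+n≡m (<⇒≤ 1+m<e)) ≤-refl
    ... | inj₁ a₁₊ₘ≡b₁₊ₘ = gap (suc m) ≤-refl 1+m<e
            (suc m + d , s≤s z≤n , ≤-trans (+-monoˡ-≤ d (<⇒≤ 1+m<e)) e+d≤k , a₁₊ₘ≡b₁₊ₘ)
    ... | inj₂ (a₁₊ₘ<b₁₊ₘ , _) = b-leftmost-above-common 1≤m 1+m<e e+d≤k aₘ≡bₘ aₑ≡bₑ a₁₊ₘ<b₁₊ₘ

  no-gap-between-commons : ∀ {m e} → 1 ≤ m → suc m < e → e ≤ k → InA m → InA e →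
    ¬ (∀ x → m < x → x < e → ¬ InA x)
  no-gap-between-commons {m} {e} 1≤m 1+m<e e≤k (l , 1≤l , l≤k , aₗ≡bₘ) (i , 1≤i , i≤k , aᵢ≡bₑ)
    with m≤n⇒∃[o]m+o≡n (common-index-≤ 1≤i e≤k aᵢ≡bₑ)
  ... | d , refl with common-offset 1≤m (<-trans (n<1+n m) 1+m<e) i≤k 1≤l l≤k aᵢ≡bₑ aₗ≡bₘ
  ...   | refl = gap-impossible 1≤m 1+m<e i≤k aₗ≡bₘ aᵢ≡bₑ

  b-never-returns : ∀ e → 2 ≤ e → e ≤ k → InA e → ¬ InA (e ∸ 1) → ∀ m → 1 ≤ m → m < e → ¬ InA m
  b-never-returns (suc e) _ 1+e≤k InA-1+e ¬InA-e m 1≤m (s≤s m≤e) =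
    absent (e ∸ m) m 1≤m (m∸n+n≡m m≤e) m ≤-refl m≤e
    where
    absent : ∀ g x → 1 ≤ x → g + x ≡ e → ∀ y → x ≤ y → y ≤ e → ¬ InA y
    absent zero    x _   refl y x≤y y≤x = subst (¬_ ∘ InA) (≤-antisym x≤y y≤x) ¬InA-e
    absent (suc g) x 1≤x g+1+x≡e y x≤y y≤e =
      [ (λ x<y → absent-above y x<y y≤e) , (λ x≡y → subst (¬_ ∘ InA) x≡y ¬InA-x) ]′ (m≤n⇒m<n∨m≡n x≤y)
      where
      absent-above : ∀ y → suc x ≤ y → y ≤ e → ¬ InA y
      absent-above = absent g (suc x) (s≤s z≤n) (trans (+-suc g x) g+1+x≡e)
      1+x≤e : suc x ≤ e
      1+x≤e = subst (suc x ≤_) g+1+x≡e (s≤s (m≤n+m x g))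
      ¬InA-x : ¬ InA x
      ¬InA-x InA-x = no-gap-between-commons 1≤x (s≤s 1+x≤e) 1+e≤k InA-x InA-1+e
        (λ z x<z z<1+e → absent-above z x<z (≤-pred z<1+e))

  b-common-contiguous : Contiguous k b a
  b-common-contiguous i j l 1≤i i≤j j≤l l≤k InA-i InA-l with InSeq? k (b j) a
  ... | yes InA-j = InA-j
  ... | no ¬InA-j with step-up (λ y → InSeq? k (b y) a) j≤l ¬InA-j InA-l
  ...   | x , j≤x , x<l , ¬InA-x , InA-1+x = ⊥-elim
    (b-never-returns (suc x) (s≤s 1≤x) (≤-trans x<l l≤k) InA-1+x ¬InA-x i 1≤i (s≤s i≤x) InA-i)
    where
    i≤x : i ≤ x
    i≤x = ≤-trans i≤j j≤x
    1≤x : 1 ≤ x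
    1≤x = ≤-trans 1≤i i≤x

  a-common-contiguous : Contiguous k a b
  a-common-contiguous i j l 1≤i i≤j j≤l l≤k (e , 1≤e , e≤k , bₑ≡aᵢ) (m , 1≤m , m≤k , bₘ≡aₗ) =
    matched (m≤n⇒∃[o]m+o≡n (≤-trans i≤j (m≤m+n j e)))
    where
    i≤k : i ≤ k
    i≤k = ≤-trans (≤-trans i≤j j≤l) l≤k
    1≤l : 1 ≤ l
    1≤l = ≤-trans (≤-trans 1≤i i≤j) j≤l
    i+m≡l+e : i + m ≡ l + e
    i+m≡l+e = common-shift 1≤i i≤k e≤k 1≤l l≤k m≤k 1≤m 1≤e (sym bₑ≡aᵢ) (sym bₘ≡aₗ)
    matched : (∃ λ y → i + y ≡ j + e) → InSeq k (a j) b
    matched (y , i+y≡j+e) = y , 1≤y , y≤k ,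
      bᵧ≡aⱼ (b-common-contiguous e y m 1≤e e≤y y≤m m≤k
               (i , 1≤i , i≤k , sym bₑ≡aᵢ) (l , 1≤l , l≤k , sym bₘ≡aₗ))
      where
      e≤y : e ≤ y
      e≤y = +-cancelˡ-≤ i e y (≤-trans (+-monoˡ-≤ e i≤j) (≤-reflexive (sym i+y≡j+e)))
      y≤m : y ≤ m
      y≤m = +-cancelˡ-≤ i y m
        (≤-trans (≤-reflexive i+y≡j+e) (≤-trans (+-monoˡ-≤ e j≤l) (≤-reflexive (sym i+m≡l+e))))
      1≤y : 1 ≤ y
      1≤y = ≤-trans 1≤e e≤y
      y≤k : y ≤ k
      y≤k = ≤-trans y≤m m≤k
      bᵧ≡aⱼ : InA y → b y ≡ a j
      bᵧ≡aⱼ (z , 1≤z , z≤k , a_z≡bᵧ) = trans (sym a_z≡bᵧ) (cong a (+-cancelʳ-≡ e z j z+e≡j+e))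
        where
        z+e≡j+e : z + e ≡ j + e
        z+e≡j+e =
          trans (sym (common-shift 1≤i i≤k e≤k 1≤z z≤k y≤k 1≤y 1≤e (sym bₑ≡aᵢ) a_z≡bᵧ)) i+y≡j+e

-- The hypothesis HasDecSub π k is implied by IsBSeq π k b.
proposition21 : ∀ {n} (π : Permutation′ n) (k : ℕ) → 2 ≤ k → HasDecSub π k →
    (a b : ℕ → Fin n) → IsASeq π k a → IsBSeq π k b →
    (∀ e → 2 ≤ e → e ≤ k → InSeq k (b e) a → ¬ InSeq k (b (e ∸ 1)) a →
       ∀ m → 1 ≤ m → m < e → ¬ InSeq k (b m) a)
    × Contiguous k a b × Contiguous k b a
proposition21 π k 2≤k _ a b A B = b-never-returns , a-common-contiguous , b-common-contiguous
  where open ABSequences π k (≤-trans (s≤s z≤n) 2≤k) a b A B
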